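{- Let $A$ be a finite set and $(X_a)_{a\in A}$ an indexed family of non-empty finite subsets of $\mathbb{Z}$. There exist a tree $H$ with vertex set $A$ and an antisymmetric edge-weight function $\varpi$ on $H$ satisfying: (1) every integer in the range of $\varpi$ can be written as the difference of two elements of $\bigcup_{a\in A}X_a$; (2) every element of $S(H,\varpi)$ is an optimum solution, i.e. every $(t_a)_{a\in A}\in S(H,\varpi)$ minimizes $\left|\bigcup_{a\in A}(X_a+t_a)\right|$ over all of $\mathbb{Z}^A$.
   Context: For a graph $G=(V,E)$ let $\tilde E=\{(a,b)\in V\times V : \{a,b\}\in E\}$. An antisymmetric edge-weight function on $G$ is a function $\varpi:\tilde E\to\mathbb{Z}$ with $\varpi(b,c)=-\varpi(c,b)$ for all $(b,c)\in\tilde E$. $S(G,\varpi)$ denotes the set of all $(t_a)_{a\in V}\in\mathbb{Z}^V$ such that $t_b-t_c=\varpi(b,c)$ for all $(b,c)\in\tilde E$. A tree is a connected acyclic graph. Here $X+t=\{x+t: x\in X\}$. -}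

module Defs where

open import Data.Nat using (ℕ; _≤_)
open import Data.Fin using (Fin)
open import Data.Integer using (ℤ; _+_; _-_; -_)
import Data.Integer as ℤ
open import Data.List using (List; []; _∷_; _++_; [_]; map; concatMap; length; deduplicate)
open import Data.List.Relation.Unary.Linked using (Linked)
open import Data.List.Relation.Unary.Unique.Propositional using (Unique)
open import Data.List.Membership.Propositional using (_∈_)
open import Data.Vec.Functional using (Vector)
open import Data.Fin.Base using () 
open import Data.List using (allFin)
open import Data.Product using (Σ; ∃; _×_; _,_)
open import Relation.Binary.PropositionalEquality using (_≡_)
open import Relation.Nullary using (¬_)

record Graph (n : ℕ) : Set₁ where
  field
    Adj   : Fin n → Fin n → Set
    sym   : ∀ {a b} → Adj a b → Adj b a
    irref : ∀ {a} → ¬ Adj a a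
open Graph public

data Walk {n : ℕ} (G : Graph n) : Fin n → Fin n → Set where
  here : ∀ {a} → Walk G a a
  step : ∀ {a b c} → Adj G a b → Walk G b c → Walk G a c

Connected : ∀ {n} → Graph n → Set
Connected G = ∀ a b → Walk G a b

-- a cycle: distinct vertices v ∷ ws (at least 3 of them), consecutive ones adjacent,
-- and the last one adjacent to v
record Cycle {n : ℕ} (G : Graph n) : Set where
  field
    v      : Fin n
    ws     : List (Fin n)
    long   : 2 ≤ length ws
    unique : Unique (v ∷ ws)
    closed : Linked (Adj G) (v ∷ ws ++ [ v ])

Acyclic : ∀ {n} → Graph n → Set
Acyclic G = ¬ Cycle G

IsTree : ∀ {n} → Graph n → Set
IsTree G = Connected G × Acyclic G

-- antisymmetric edge-weight functions (only values on edges matter)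
IsAntisymmetricWeight : ∀ {n} → Graph n → (Fin n → Fin n → ℤ) → Set
IsAntisymmetricWeight G ϖ = ∀ a b → Adj G a b → ϖ b a ≡ - ϖ a b

InS : ∀ {n} → (G : Graph n) → (Fin n → Fin n → ℤ) → (Fin n → ℤ) → Set
InS G ϖ t = ∀ a b → Adj G a b → t a - t b ≡ ϖ a b

-- finite subsets of ℤ are represented by lists (set semantics)
translate : List ℤ → ℤ → List ℤ
translate X t = map (_+ t) X

unionTr : ∀ {n} → (Fin n → List ℤ) → (Fin n → ℤ) → List ℤ
unionTr {n} X t = concatMap (λ a → translate (X a) (t a)) (allFin n)

union : ∀ {n} → (Fin n → List ℤ) → List ℤ
union {n} X = concatMap X (allFin n)

card : List ℤ → ℕ
card xs = length (deduplicate ℤ._≟_ xs)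

NonEmptyList : List ℤ → Set
NonEmptyList xs = ¬ (xs ≡ [])

-- Say a and b overlap under t when X a + t a and X b + t b meet.
--  * Shifting a block of indices that overlaps nothing outside it never increases the
--    cost (the block and the rest cover disjoint parts of the union): cost-shiftOn.
--  * Hence from any t₀ we grow, at no extra cost, an overlap tree spanning all indices,
--    encoded by a parent map with rank decreasing towards the root: Growth.spanning.
--  * Along such a tree t a - t root is a sum of at most n differences of elements of
--    ⋃ X, so some member of a finite list of candidates is optimal: Growth.best-optimal.
--  * Trees of parent maps with decreasing rank are trees (RankedTree), and for the
--    weights ϖ(a,b) = t a - t b the solutions of S(H, ϖ) on a connected H are the
--    translates of t (solution-translate). Applying this to the spanning overlap tree
--    of an optimal t gives the theorem; overlapping edges have the required weights.
module Submission where

open import Defs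
open import Data.Nat using (ℕ; _≤_)
open import Data.Fin using (Fin)
open import Data.Integer using (ℤ; _-_)
open import Data.List using (List)
open import Data.List.Membership.Propositional using (_∈_)
open import Data.Product using (Σ; ∃; _×_; _,_)
open import Relation.Binary.PropositionalEquality using (_≡_)

open import Data.Nat using (zero; suc; _<_; z≤n; s≤s)
import Data.Nat as ℕ
import Data.Nat.Properties as ℕP
open import Data.Fin using (zero; suc)
import Data.Fin.Properties as FinP
open import Data.Integer using (_+_; -_; +_)
import Data.Integer as ℤ
import Data.Integer.Properties as ℤP
open import Data.Integer.Tactic.RingSolver using (solve-∀)
open import Data.List using ([]; _∷_; _++_; [_]; map; concatMap; length; deduplicate; allFin; filter)
import Data.List.Properties as ListP
open import Data.List.Membership.Propositional using (_∉_; find; lose)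
open import Data.List.Membership.Propositional.Properties
  using ( ∈-++⁺ˡ; ∈-++⁺ʳ; ∈-++⁻; ∈-map⁺; ∈-map⁻; ∈-allFin; ∈-filter⁺; ∈-filter⁻
        ; ∈-deduplicate⁺; ∈-deduplicate⁻; ∈-concatMap⁺; ∈-concatMap⁻)
open import Data.List.Relation.Binary.Subset.Propositional using (_⊆_)
open import Data.List.Relation.Binary.Subset.Propositional.Properties using (++⁺; map⁺; concatMap⁺)
open import Data.List.Relation.Binary.Disjoint.Propositional using (Disjoint)
open import Data.List.Relation.Unary.All using (All; []; _∷_)
import Data.List.Relation.Unary.All as All
open import Data.List.Relation.Unary.Any using (Any; here; there; any?)
open import Data.List.Relation.Unary.AllPairs using ([]; _∷_)
open import Data.List.Relation.Unary.Unique.Propositional using (Unique)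
import Data.List.Relation.Unary.Unique.Propositional.Properties as UniqueP
open import Data.List.Relation.Unary.Unique.DecPropositional.Properties ℤ._≟_ using (deduplicate-!)
open import Data.List.Relation.Unary.Linked using (Linked; _∷_)
open import Data.Vec.Functional using (Vector; updateAt) renaming (_∷_ to _∷ᵛ_)
open import Data.Vec.Functional.Properties using (updateAt-updates; updateAt-minimal)
open import Data.List.Extrema.Nat using (argmin; f[argmin]≤f[xs])
open import Data.Product using (proj₁; proj₂)
open import Data.Sum using (_⊎_; inj₁; inj₂)
open import Data.Empty using (⊥; ⊥-elim)
open import Data.Unit using (⊤; tt)
open import Relation.Nullary using (¬_; Dec; yes; no)
open import Relation.Nullary.Decidable using (¬?; _×-dec_; map′; decidable-stable)
open import Relation.Binary.PropositionalEquality using (refl; trans; cong; subst; subst₂; _≢_; _≗_)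
import Relation.Binary.PropositionalEquality as ≡
open import Function using (_∘_)

module _ {A : Set} where

  remove : ∀ {x : A} (ys : List A) → x ∈ ys → List A
  remove (_ ∷ ys) (here _)  = ys
  remove (y ∷ ys) (there p) = y ∷ remove ys p

  length-remove : ∀ {x : A} ys (p : x ∈ ys) → length ys ≡ suc (length (remove ys p))
  length-remove (_ ∷ _)  (here _)  = refl
  length-remove (_ ∷ ys) (there p) = cong suc (length-remove ys p)

  ∈-remove : ∀ {x z : A} ys (p : x ∈ ys) → z ∈ ys → z ≢ x → z ∈ remove ys p
  ∈-remove (_ ∷ _)  (here refl) (here refl) z≢x = ⊥-elim (z≢x refl)
  ∈-remove (_ ∷ _)  (here refl) (there q)   _   = q
  ∈-remove (_ ∷ _)  (there p)   (here refl) _   = here refl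
  ∈-remove (_ ∷ ys) (there p)   (there q)   z≢x = there (∈-remove ys p q z≢x)

  unique⊆⇒length≤ : ∀ {xs ys : List A} → Unique xs → xs ⊆ ys → length xs ≤ length ys
  unique⊆⇒length≤ {[]}     _            _   = z≤n
  unique⊆⇒length≤ {x ∷ xs} {ys} (x∉xs ∷ u) xs⊆ys =
    subst (suc (length xs) ≤_) (≡.sym (length-remove ys x∈ys))
      (s≤s (unique⊆⇒length≤ u λ z∈xs →
        ∈-remove ys x∈ys (xs⊆ys (there z∈xs)) (λ z≡x → All.lookup x∉xs z∈xs (≡.sym z≡x))))
    where
    x∈ys : x ∈ ys
    x∈ys = xs⊆ys (here refl)

  unique-cons : ∀ {b : A} {L} → b ∉ L → Unique L → Unique (b ∷ L)
  unique-cons {b} {L} b∉L u = All.tabulate (λ c∈L b≡c → b∉L (subst (_∈ L) (≡.sym b≡c) c∈L)) ∷ u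

  -- Entries two positions apart differ: a walk along the list never turns straight back.
  NoReturn : List A → Set
  NoReturn (a ∷ b ∷ c ∷ rest) = a ≢ c × NoReturn (b ∷ c ∷ rest)
  NoReturn _                  = ⊤

  unique⇒noReturn : ∀ ws {v} → Unique ws → All (_≢ v) ws → NoReturn (ws ++ [ v ])
  unique⇒noReturn []                  _                    _              = tt
  unique⇒noReturn (_ ∷ [])            _                    _              = tt
  unique⇒noReturn (_ ∷ _ ∷ [])        _                    (a≢v ∷ _)      = a≢v , tt
  unique⇒noReturn (_ ∷ b ∷ c ∷ rest) ((_ ∷ a≢c ∷ _) ∷ u) (_ ∷ others≢v) =
    a≢c , unique⇒noReturn (b ∷ c ∷ rest) u others≢v

  lastOf : A → List A → A
  lastOf x []       = x
  lastOf _ (y ∷ ys) = lastOf y ys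

  lastOf-snoc : ∀ x ys v → lastOf x (ys ++ [ v ]) ≡ v
  lastOf-snoc _ []       _ = refl
  lastOf-snoc _ (y ∷ ys) v = lastOf-snoc y ys v

  lastOf-∈ : ∀ x ys → lastOf x ys ∈ x ∷ ys
  lastOf-∈ _ []       = here refl
  lastOf-∈ _ (y ∷ ys) = there (lastOf-∈ y ys)

  LastStep : (A → A → Set) → A → A → List A → Set
  LastStep R a b []       = R a b
  LastStep R _ b (c ∷ cs) = LastStep R b c cs

  lastStep-snoc : ∀ {R} x y ys v → LastStep R x y (ys ++ [ v ]) → R (lastOf y ys) v
  lastStep-snoc _ _ []       _ r = r
  lastStep-snoc _ y (z ∷ zs) v r = lastStep-snoc y z zs v r

  vectorsOver : (k : ℕ) → List A → List (Vector A k)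
  vectorsOver zero    _  = [ (λ ()) ]
  vectorsOver (suc k) xs = concatMap (λ x → map (x ∷ᵛ_) (vectorsOver k xs)) xs

  vectorsOver-complete : ∀ k xs (f : Vector A k) → (∀ i → f i ∈ xs) →
                         ∃ λ g → g ∈ vectorsOver k xs × g ≗ f
  vectorsOver-complete zero    _  f _   = (λ ()) , here refl , λ ()
  vectorsOver-complete (suc k) xs f f∈ =
    let g , g∈ , g≗ = vectorsOver-complete k xs (f ∘ suc) (f∈ ∘ suc)
        agree : f zero ∷ᵛ g ≗ f
        agree = λ { zero → refl ; (suc i) → g≗ i }
    in f zero ∷ᵛ g
     , ∈-concatMap⁺ (λ x → map (x ∷ᵛ_) (vectorsOver k xs)) (lose (f∈ zero) (∈-map⁺ (f zero ∷ᵛ_) g∈))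
     , agree

translate-undo : ∀ z d → (z + d) + - d ≡ z
translate-undo = solve-∀

difference-antisym : ∀ x y → y - x ≡ - (x - y)
difference-antisym = solve-∀

difference-transfer : ∀ x y u v → x - y ≡ u - v → x - u ≡ y - v
difference-transfer x y u v eq = begin
  x - u                 ≡⟨ split x y u ⟩
  (x - y) + (y - u)     ≡⟨ cong (_+ (y - u)) eq ⟩
  (u - v) + (y - u)     ≡⟨ rearrange u v y ⟩
  y - v                 ∎
  where
  open ≡.≡-Reasoning
  split : ∀ x y u → x - u ≡ (x - y) + (y - u)
  split = solve-∀
  rearrange : ∀ u v y → (u - v) + (y - u) ≡ y - v
  rearrange = solve-∀

add-difference : ∀ x y → x ≡ y + (x - y)
add-difference = solve-∀

difference-of-meeting : ∀ x y u v → x + u ≡ y + v → u - v ≡ y - x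
difference-of-meeting x y u v eq = begin
  u - v               ≡⟨ expand x u v ⟩
  (x + u) - x - v     ≡⟨ cong (λ w → w - x - v) eq ⟩
  (y + v) - x - v     ≡⟨ collapse y v x ⟩
  y - x               ∎
  where
  open ≡.≡-Reasoning
  expand : ∀ x u v → u - v ≡ (x + u) - x - v
  expand = solve-∀
  collapse : ∀ y v x → (y + v) - x - v ≡ y - x
  collapse = solve-∀

meet-after-shift : ∀ x y u v → x + (u + ((y + v) - (x + u))) ≡ y + v
meet-after-shift = solve-∀

offset-via : ∀ ta tp tr → ta - tr ≡ (tp - tr) + (ta - tp)
offset-via = solve-∀

unique-length≤ : ∀ {n} {L : List (Fin n)} → Unique L → length L ≤ n
unique-length≤ {n} {L} u =
  subst (length L ≤_) (ListP.length-tabulate {n = n} (λ i → i)) (unique⊆⇒length≤ u (λ {a} _ → ∈-allFin a))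

missing⇒length< : ∀ {n} {L : List (Fin n)} {b} → Unique L → b ∉ L → length L < n
missing⇒length< u b∉L = unique-length≤ (unique-cons b∉L u)

dedup : List ℤ → List ℤ
dedup = deduplicate ℤ._≟_

⊆dedup : ∀ {xs} → xs ⊆ dedup xs
⊆dedup = ∈-deduplicate⁺ ℤ._≟_

dedup⊆ : ∀ {xs} → dedup xs ⊆ xs
dedup⊆ {xs} = ∈-deduplicate⁻ ℤ._≟_ xs

card≤length : ∀ {xs ys} → xs ⊆ ys → card xs ≤ length ys
card≤length {xs} xs⊆ys = unique⊆⇒length≤ (deduplicate-! xs) (xs⊆ys ∘ dedup⊆)

card-mono : ∀ {xs ys} → xs ⊆ ys → card xs ≤ card ys
card-mono xs⊆ys = card≤length (⊆dedup ∘ xs⊆ys)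

card-++ : ∀ xs ys → card (xs ++ ys) ≤ card xs ℕ.+ card ys
card-++ xs ys = ℕP.≤-trans (card≤length (++⁺ (⊆dedup {xs}) (⊆dedup {ys})))
                           (ℕP.≤-reflexive (ListP.length-++ (dedup xs)))

card-disjoint : ∀ {V W U} → Disjoint V W → V ⊆ U → W ⊆ U → card V ℕ.+ card W ≤ card U
card-disjoint {V} {W} {U} V#W V⊆U W⊆U =
  subst (_≤ card U) (ListP.length-++ (dedup V))
    (unique⊆⇒length≤ (UniqueP.++⁺ (deduplicate-! V) (deduplicate-! W) λ (v∈ , w∈) → V#W (dedup⊆ v∈ , dedup⊆ w∈))
                     (⊆dedup ∘ union⊆))
  where
  union⊆ : dedup V ++ dedup W ⊆ U
  union⊆ z∈ with ∈-++⁻ (dedup V) z∈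
  ... | inj₁ z∈V = V⊆U (dedup⊆ z∈V)
  ... | inj₂ z∈W = W⊆U (dedup⊆ z∈W)

card-map : ∀ f xs → card (map f xs) ≤ card xs
card-map f xs =
  ℕP.≤-trans (card≤length (map⁺ f (⊆dedup {xs}))) (ℕP.≤-reflexive (ListP.length-map f (dedup xs)))

-- Translation is a bijection of ℤ, so it preserves cardinality.
card-translate : ∀ xs d → card (translate xs d) ≡ card xs
card-translate xs d = ℕP.≤-antisym (card-map (_+ d) xs)
  (ℕP.≤-trans (card-mono back) (card-map (_+ - d) (translate xs d)))
  where
  back : xs ⊆ translate (translate xs d) (- d)
  back {z} z∈ = subst (_∈ translate (translate xs d) (- d)) (translate-undo z d)
                      (∈-map⁺ (_+ - d) (∈-map⁺ (_+ d) z∈))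

module _ {n : ℕ} {G : Graph n} where

  _++ʷ_ : ∀ {a b c} → Walk G a b → Walk G b c → Walk G a c
  here       ++ʷ w = w
  step e w′  ++ʷ w = step e (w′ ++ʷ w)

  reverseOnto : ∀ {a b c} → Walk G a b → Walk G a c → Walk G b c
  reverseOnto here       acc = acc
  reverseOnto (step e w) acc = reverseOnto w (step (Graph.sym G e) acc)

  connected-via : ∀ r → (∀ a → Walk G a r) → Connected G
  connected-via r toR a b = toR a ++ʷ reverseOnto (toR b) here

potentialWeight : ∀ {n} → (Fin n → ℤ) → Fin n → Fin n → ℤ
potentialWeight t a b = t a - t b

module _ {n : ℕ} (G : Graph n) (t : Fin n → ℤ) where

  potentialWeight-antisym : IsAntisymmetricWeight G (potentialWeight t)
  potentialWeight-antisym a b _ = difference-antisym (t a) (t b)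

  solution-walk : ∀ {s} → InS G (potentialWeight t) s → ∀ {a b} → Walk G a b → s a - t a ≡ s b - t b
  solution-walk s∈S here = refl
  solution-walk {s} s∈S {a} (step {b = c} e w) =
    trans (difference-transfer (s a) (s c) (t a) (t c) (s∈S a c e)) (solution-walk {s} s∈S w)

  solution-translate : Connected G → ∀ r {s} → InS G (potentialWeight t) s → ∀ a → s a ≡ t a + (s r - t r)
  solution-translate conn r {s} s∈S a =
    trans (add-difference (s a) (t a)) (cong (λ d → t a + d) (solution-walk {s} s∈S (conn a r)))

module RankedTree {n : ℕ} (parent : Fin n → Fin n) (rank : Fin n → ℕ) where

  ChildOf : Fin n → Fin n → Set
  ChildOf a b = parent a ≡ b × rank b < rank a

  ParentOf : Fin n → Fin n → Set
  ParentOf a b = ChildOf b a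

  treeGraph : Graph n
  treeGraph = record
    { Adj   = λ a b → ChildOf a b ⊎ ParentOf a b
    ; sym   = λ { (inj₁ c) → inj₂ c ; (inj₂ c) → inj₁ c }
    ; irref = λ { (inj₁ (_ , r<)) → ℕP.<-irrefl refl r< ; (inj₂ (_ , r<)) → ℕP.<-irrefl refl r< } }

  -- A walk that never turns back and steps down from a parent to a child keeps
  -- stepping down: leaving b towards anything but its parent a means visiting a child.
  keepsDescending : ∀ {a b} rest → ParentOf a b → Linked (Adj treeGraph) (a ∷ b ∷ rest) →
                    NoReturn (a ∷ b ∷ rest) → rank a < rank (lastOf b rest) × LastStep ParentOf a b rest
  keepsDescending []       a→b _ _ = proj₂ a→b , a→b
  keepsDescending (c ∷ cs) (pb≡a , _) (_ ∷ inj₁ (pb≡c , _) ∷ _) (a≢c , _) =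
    ⊥-elim (a≢c (trans (≡.sym pb≡a) pb≡c))
  keepsDescending (c ∷ cs) (_ , ra<rb) (_ ∷ walk@(inj₂ b→c ∷ _)) (_ , noReturn) =
    let rb<rz , lastDown = keepsDescending cs b→c walk noReturn in ℕP.<-trans ra<rb rb<rz , lastDown

  walkShape : ∀ {a b} rest → Linked (Adj treeGraph) (a ∷ b ∷ rest) → NoReturn (a ∷ b ∷ rest) →
              rank (lastOf b rest) < rank a ⊎ LastStep ParentOf a b rest
  walkShape rest     walk@(inj₂ a→b ∷ _) noReturn = inj₂ (proj₂ (keepsDescending rest a→b walk noReturn))
  walkShape []       (inj₁ (_ , rb<ra) ∷ _) _ = inj₁ rb<ra
  walkShape (c ∷ cs) (inj₁ (_ , rb<ra) ∷ walk) (_ , noReturn) with walkShape cs walk noReturn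
  ... | inj₁ rz<rb  = inj₁ (ℕP.<-trans rz<rb rb<ra)
  ... | inj₂ lastDown = inj₂ lastDown

  -- A closed walk v w₁ … wₖ v (k ≥ 2) without returns would have to leave v upwards
  -- (else ranks grow all the way round) and re-enter it downwards (else ranks fall),
  -- making both w₁ and wₖ the parent of v.
  noClosedWalk : ∀ v w₁ w₂ ws → All (w₁ ≢_) (w₂ ∷ ws) →
                 Linked (Adj treeGraph) (v ∷ w₁ ∷ w₂ ∷ ws ++ [ v ]) → NoReturn (v ∷ w₁ ∷ w₂ ∷ ws ++ [ v ]) → ⊥
  noClosedWalk v w₁ w₂ ws w₁∉ws closed noReturn with closed | walkShape (w₂ ∷ ws ++ [ v ]) closed noReturn
  ... | inj₂ v→w₁ ∷ _ | _ = ℕP.<-irrefl refl (subst (λ z → rank v < rank z) (lastOf-snoc w₂ ws v)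
                                                     (proj₁ (keepsDescending _ v→w₁ closed noReturn)))
  ... | inj₁ _ ∷ _ | inj₁ back< =
    ℕP.<-irrefl refl (subst (λ z → rank z < rank v) (lastOf-snoc w₂ ws v) back<)
  ... | inj₁ (pv≡w₁ , _) ∷ _ | inj₂ lastDown = All.lookup w₁∉ws (lastOf-∈ w₂ ws)
          (trans (≡.sym pv≡w₁) (proj₁ (lastStep-snoc {R = ParentOf} w₁ w₂ ws v lastDown)))

  -- The vertices of a cycle are distinct, so walking round it never turns back.
  acyclic : Acyclic treeGraph
  acyclic record { ws = [] ; long = () }
  acyclic record { ws = _ ∷ [] ; long = s≤s () }
  acyclic record { v = v ; ws = w₁ ∷ w₂ ∷ ws ; closed = closed
                 ; unique = v∉ws@(_ ∷ v≢w₂ ∷ _) ∷ unique@(w₁∉ws ∷ _) } =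
    noClosedWalk v w₁ w₂ ws w₁∉ws closed
      (v≢w₂ , unique⇒noReturn (w₁ ∷ w₂ ∷ ws) unique (All.map (λ v≢w w≡v → v≢w (≡.sym w≡v)) v∉ws))

  module _ (root : Fin n) (descends : ∀ a → a ≡ root ⊎ rank (parent a) < rank a) where

    walkToRoot : ∀ k a → rank a < k → Walk treeGraph a root
    walkToRoot (suc k) a ra<k with descends a
    ... | inj₁ refl      = here
    ... | inj₂ rpa<ra    =
      step (inj₁ (refl , rpa<ra)) (walkToRoot k (parent a) (ℕP.<-≤-trans rpa<ra (ℕP.≤-pred ra<k)))

    isTree : IsTree treeGraph
    isTree = connected-via root (λ a → walkToRoot (suc (rank a)) a ℕP.≤-refl) , acyclic

module Overlaps {n : ℕ} (X : Fin n → List ℤ) where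

  open import Data.List.Membership.DecPropositional (FinP._≟_ {n}) using (_∈?_)

  cost : (Fin n → ℤ) → ℕ
  cost t = card (unionTr X t)

  ∈-union⁺ : ∀ {a x} → x ∈ X a → x ∈ union X
  ∈-union⁺ {a} x∈ = ∈-concatMap⁺ X (lose (∈-allFin a) x∈)

  blocks : (Fin n → ℤ) → List (Fin n) → List ℤ
  blocks t = concatMap (λ a → translate (X a) (t a))

  ∈-blocks⁺ : ∀ {t as a x} → a ∈ as → x ∈ X a → x + t a ∈ blocks t as
  ∈-blocks⁺ {t} {a = a} a∈ x∈ = ∈-concatMap⁺ (λ a → translate (X a) (t a)) (lose a∈ (∈-map⁺ (_+ t a) x∈))

  ∈-blocks⁻ : ∀ {t} as {z} → z ∈ blocks t as → ∃ λ a → ∃ λ x → a ∈ as × x ∈ X a × z ≡ x + t a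
  ∈-blocks⁻ {t} as z∈ =
    let a , a∈ , z∈a = find (∈-concatMap⁻ (λ a → translate (X a) (t a)) {as} z∈)
        x , x∈ , z≡  = ∈-map⁻ (_+ t a) z∈a
    in a , x , a∈ , x∈ , z≡

  blocks⊆unionTr : ∀ t as → blocks t as ⊆ unionTr X t
  blocks⊆unionTr t as = concatMap⁺ (λ a → translate (X a) (t a)) as⊆allFin
    where
    as⊆allFin : as ⊆ allFin n
    as⊆allFin {a} _ = ∈-allFin a

  cost-uniform-≤ : ∀ {t t′} c → (∀ a → t′ a ≡ t a + c) → cost t′ ≤ cost t
  cost-uniform-≤ {t} {t′} c t′≡ =
    ℕP.≤-trans (card-mono moved) (ℕP.≤-reflexive (card-translate (unionTr X t) c))
    where
    moved : unionTr X t′ ⊆ translate (unionTr X t) c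
    moved z∈ with ∈-blocks⁻ (allFin n) z∈
    ... | a , x , a∈ , x∈ , refl = subst (_∈ translate (unionTr X t) c)
            (trans (ℤP.+-assoc x (t a) c) (cong (λ w → x + w) (≡.sym (t′≡ a))))
            (∈-map⁺ (_+ c) (∈-blocks⁺ a∈ x∈))

  cost-uniform : ∀ {t t′} c → (∀ a → t′ a ≡ t a + c) → cost t′ ≡ cost t
  cost-uniform {t} {t′} c t′≡ = ℕP.≤-antisym (cost-uniform-≤ c t′≡) (cost-uniform-≤ (- c) back)
    where
    back : ∀ a → t a ≡ t′ a + - c
    back a = trans (≡.sym (translate-undo (t a) c)) (cong (_+ - c) (≡.sym (t′≡ a)))

  cost-≗ : ∀ {t t′} → t′ ≗ t → cost t′ ≡ cost t
  cost-≗ t′≗t = cost-uniform (+ 0) λ a → trans (t′≗t a) (≡.sym (ℤP.+-identityʳ _))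

  Overlap : (Fin n → ℤ) → Fin n → Fin n → Set
  Overlap t a b = ∃ λ x → ∃ λ y → x ∈ X a × y ∈ X b × x + t a ≡ y + t b

  overlap? : ∀ t a b → Dec (Overlap t a b)
  overlap? t a b = map′ fromAny toAny (any? (λ x → any? (λ y → x + t a ℤ.≟ y + t b) (X b)) (X a))
    where
    fromAny : Any (λ x → Any (λ y → x + t a ≡ y + t b) (X b)) (X a) → Overlap t a b
    fromAny witness = let x , x∈ , inner = find witness ; y , y∈ , eq = find inner in x , y , x∈ , y∈ , eq
    toAny : Overlap t a b → Any (λ x → Any (λ y → x + t a ≡ y + t b) (X b)) (X a)
    toAny (_ , _ , x∈ , y∈ , eq) = lose x∈ (lose y∈ eq)

  overlap-sym : ∀ {t a b} → Overlap t a b → Overlap t b a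
  overlap-sym (x , y , x∈ , y∈ , eq) = y , x , y∈ , x∈ , ≡.sym eq

  overlap-difference : ∀ {t a b} → Overlap t a b →
                       ∃ λ x → ∃ λ y → x ∈ union X × y ∈ union X × t a - t b ≡ x - y
  overlap-difference {t} {a} {b} (x , y , x∈ , y∈ , eq) =
    y , x , ∈-union⁺ y∈ , ∈-union⁺ x∈ , difference-of-meeting x y (t a) (t b) eq

  overlap-shift : ∀ {t t′ a b} d → t′ a ≡ t a + d → t′ b ≡ t b + d → Overlap t a b → Overlap t′ a b
  overlap-shift {t} {t′} {a} {b} d ta′ tb′ (x , y , x∈ , y∈ , eq) = x , y , x∈ , y∈ , (begin
    x + t′ a         ≡⟨ cong (λ w → x + w) ta′ ⟩
    x + (t a + d)    ≡⟨ ≡.sym (ℤP.+-assoc x (t a) d) ⟩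
    (x + t a) + d    ≡⟨ cong (_+ d) eq ⟩
    (y + t b) + d    ≡⟨ ℤP.+-assoc y (t b) d ⟩
    y + (t b + d)    ≡⟨ cong (λ w → y + w) (≡.sym tb′) ⟩
    y + t′ b         ∎)
    where open ≡.≡-Reasoning

  shiftOn : (Fin n → ℤ) → List (Fin n) → ℤ → Fin n → ℤ
  shiftOn t L d c with c ∈? L
  ... | yes _ = t c + d
  ... | no  _ = t c

  shiftOn-∈ : ∀ t {L} d {c} → c ∈ L → shiftOn t L d c ≡ t c + d
  shiftOn-∈ t {L} d {c} c∈ with c ∈? L
  ... | yes _  = refl
  ... | no c∉  = ⊥-elim (c∉ c∈)

  shiftOn-∉ : ∀ t {L} d {c} → c ∉ L → shiftOn t L d c ≡ t c
  shiftOn-∉ t {L} d {c} c∉ with c ∈? L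
  ... | yes c∈ = ⊥-elim (c∉ c∈)
  ... | no  _  = refl

  Closed : (Fin n → ℤ) → List (Fin n) → Set
  Closed t L = ∀ {a c} → a ∈ L → c ∉ L → ¬ Overlap t c a

  -- Shifting a closed block does not increase the cost: before the shift the block and
  -- its complement cover disjoint parts of the union, afterwards at most their sizes add up.
  cost-shiftOn : ∀ {t L} d → Closed t L → cost (shiftOn t L d) ≤ cost t
  cost-shiftOn {t} {L} d closed = begin
    cost (shiftOn t L d)                          ≤⟨ card-mono split ⟩
    card (translate inside d ++ outside)           ≤⟨ card-++ (translate inside d) outside ⟩
    card (translate inside d) ℕ.+ card outside    ≡⟨ cong (ℕ._+ card outside) (card-translate inside d) ⟩
    card inside ℕ.+ card outside                  ≤⟨ card-disjoint disjoint (blocks⊆unionTr t L)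
                                                                             (blocks⊆unionTr t outsideL) ⟩
    cost t                                        ∎
    where
    open ℕP.≤-Reasoning
    outside? : ∀ c → Dec (c ∉ L)
    outside? c = ¬? (c ∈? L)
    outsideL : List (Fin n)
    outsideL = filter outside? (allFin n)
    inside outside : List ℤ
    inside  = blocks t L
    outside = blocks t outsideL
    split : unionTr X (shiftOn t L d) ⊆ translate inside d ++ outside
    split z∈ with ∈-blocks⁻ (allFin n) z∈
    ... | a , x , _ , x∈ , refl with a ∈? L
    ...   | yes a∈ = ∈-++⁺ˡ (subst (_∈ translate inside d) (ℤP.+-assoc x (t a) d) (∈-map⁺ (_+ d) (∈-blocks⁺ a∈ x∈)))
    ...   | no a∉  = ∈-++⁺ʳ (translate inside d) (∈-blocks⁺ (∈-filter⁺ outside? (∈-allFin a) a∉) x∈)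
    disjoint : Disjoint inside outside
    disjoint (z∈in , z∈out) with ∈-blocks⁻ L z∈in | ∈-blocks⁻ outsideL z∈out
    ... | a , x , a∈ , x∈ , z≡ | c , y , c∈ , y∈ , z≡′ =
      closed a∈ (proj₂ (∈-filter⁻ outside? {xs = allFin n} c∈)) (y , x , y∈ , x∈ , trans (≡.sym z≡′) z≡)

  record OverlapTree (t : Fin n → ℤ) (root : Fin n) (L : List (Fin n)) : Set where
    field
      parent         : Fin n → Fin n
      rank           : Fin n → ℕ
      unique         : Unique L
      root∈          : root ∈ L
      parent∈        : ∀ {a} → a ∈ L → parent a ∈ L
      rank<          : ∀ {a} → a ∈ L → rank a < length L
      descends       : ∀ {a} → a ∈ L → a ≡ root ⊎ rank (parent a) < rank a
      overlapsParent : ∀ {a} → a ∈ L → rank (parent a) < rank a → Overlap t a (parent a)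

  seed : ∀ t root → OverlapTree t root [ root ]
  seed t root = record
    { parent = λ _ → root ; rank = λ _ → 0 ; unique = [] ∷ [] ; root∈ = here refl
    ; parent∈ = λ _ → here refl ; rank< = λ _ → s≤s z≤n
    ; descends = λ { (here refl) → inj₁ refl } ; overlapsParent = λ _ () }

  attach : ∀ {t root L b a} → OverlapTree t root L → b ∉ L → a ∈ L → Overlap t b a → OverlapTree t root (b ∷ L)
  attach {t} {root} {L} {b} {a} T b∉L a∈L b∩a = record
    { parent = parent′ ; rank = rank′ ; unique = unique-cons b∉L unique ; root∈ = there root∈
    ; parent∈ = parent∈′ ; rank< = rank<′ ; descends = descends′ ; overlapsParent = overlapsParent′ }
    where
    open OverlapTree T
    parent′ : Fin n → Fin n
    parent′ = updateAt parent b (λ _ → a)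
    rank′ : Fin n → ℕ
    rank′ = updateAt rank b (λ _ → length L)

    parent′-new : parent′ b ≡ a
    parent′-new = updateAt-updates b parent
    rank′-new : rank′ b ≡ length L
    rank′-new = updateAt-updates b rank
    ≢b : ∀ {c} → c ∈ L → c ≢ b
    ≢b c∈L c≡b = b∉L (subst (_∈ L) c≡b c∈L)
    parent′-old : ∀ {c} → c ∈ L → parent′ c ≡ parent c
    parent′-old {c} c∈L = updateAt-minimal c b parent (≢b c∈L)
    rank′-old : ∀ {c} → c ∈ L → rank′ c ≡ rank c
    rank′-old {c} c∈L = updateAt-minimal c b rank (≢b c∈L)
    rank′-of-parent′ : ∀ {c} → c ∈ L → rank′ (parent′ c) ≡ rank (parent c)
    rank′-of-parent′ c∈L = trans (cong rank′ (parent′-old c∈L)) (rank′-old (parent∈ c∈L))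
    -- The new edge goes down in rank, since every rank so far is below length L.
    newEdge : rank′ (parent′ b) < rank′ b
    newEdge = subst₂ _<_ (≡.sym (trans (cong rank′ parent′-new) (rank′-old a∈L))) (≡.sym rank′-new) (rank< a∈L)
    oldEdge : ∀ {c} → c ∈ L → rank′ (parent′ c) < rank′ c → rank (parent c) < rank c
    oldEdge c∈L = subst₂ _<_ (rank′-of-parent′ c∈L) (rank′-old c∈L)

    parent∈′ : ∀ {c} → c ∈ b ∷ L → parent′ c ∈ b ∷ L
    parent∈′ (here refl) = there (subst (_∈ L) (≡.sym parent′-new) a∈L)
    parent∈′ (there c∈L) = there (subst (_∈ L) (≡.sym (parent′-old c∈L)) (parent∈ c∈L))
    rank<′ : ∀ {c} → c ∈ b ∷ L → rank′ c < suc (length L)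
    rank<′ (here refl) = subst (_< suc (length L)) (≡.sym rank′-new) ℕP.≤-refl
    rank<′ (there c∈L) = subst (_< suc (length L)) (≡.sym (rank′-old c∈L)) (ℕP.m<n⇒m<1+n (rank< c∈L))
    descends′ : ∀ {c} → c ∈ b ∷ L → c ≡ root ⊎ rank′ (parent′ c) < rank′ c
    descends′ (here refl) = inj₂ newEdge
    descends′ (there c∈L) with descends c∈L
    ... | inj₁ c≡root = inj₁ c≡root
    ... | inj₂ down    = inj₂ (subst₂ _<_ (≡.sym (rank′-of-parent′ c∈L)) (≡.sym (rank′-old c∈L)) down)
    overlapsParent′ : ∀ {c} → c ∈ b ∷ L → rank′ (parent′ c) < rank′ c → Overlap t c (parent′ c)
    overlapsParent′ (here refl) _    = subst (Overlap t b) (≡.sym parent′-new) b∩a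
    overlapsParent′ (there c∈L) down =
      subst (Overlap t _) (≡.sym (parent′-old c∈L)) (overlapsParent c∈L (oldEdge c∈L down))

  shiftTree : ∀ {t root L} d → OverlapTree t root L → OverlapTree (shiftOn t L d) root L
  shiftTree {t} {root} {L} d T = record
    { parent = parent ; rank = rank ; unique = unique ; root∈ = root∈
    ; parent∈ = parent∈ ; rank< = rank< ; descends = descends
    ; overlapsParent = λ a∈L down →
        overlap-shift {t} {shiftOn t L d} d (shiftOn-∈ t d a∈L) (shiftOn-∈ t d (parent∈ a∈L)) (overlapsParent a∈L down) }
    where open OverlapTree T

  childOverlap : ∀ {t root L} (T : OverlapTree t root L) → (∀ a → a ∈ L) → ∀ {a b} →
                 RankedTree.ChildOf (OverlapTree.parent T) (OverlapTree.rank T) a b → Overlap t a b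
  childOverlap {t} T spans {a} (refl , down) = OverlapTree.overlapsParent T (spans a) down

  module Growth (nonEmpty : ∀ a → NonEmptyList (X a)) (root : Fin n) where

    element : ∀ a → ∃ λ x → x ∈ X a
    element a with X a | nonEmpty a
    ... | []    | ≢[] = ⊥-elim (≢[] refl)
    ... | x ∷ _ | _   = x , here refl

    realign : ∀ t {L b} → root ∈ L → b ∉ L → ∃ λ d → Overlap (shiftOn t L d) b root
    realign t {L} {b} root∈L b∉L = d , y , x , y∈ , x∈ , (begin
      y + shiftOn t L d b       ≡⟨ cong (λ w → y + w) (shiftOn-∉ t d b∉L) ⟩
      y + t b                   ≡⟨ ≡.sym (meet-after-shift x y (t root) (t b)) ⟩
      x + (t root + d)          ≡⟨ cong (λ w → x + w) (≡.sym (shiftOn-∈ t d root∈L)) ⟩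
      x + shiftOn t L d root    ∎)
      where
      open ≡.≡-Reasoning
      x y d : ℤ
      x = proj₁ (element root)
      y = proj₁ (element b)
      d = (y + t b) - (x + t root)
      x∈ : x ∈ X root
      x∈ = proj₂ (element root)
      y∈ : y ∈ X b
      y∈ = proj₂ (element b)

    record Progress (t₀ : Fin n → ℤ) : Set where
      field
        t       : Fin n → ℤ
        L       : List (Fin n)
        tree    : OverlapTree t root L
        noWorse : cost t ≤ cost t₀

    -- One more index joins the tree: an outside index meeting the tree is attached; if there is
    -- none, the tree is a closed block and may be shifted onto a missing index at no cost.
    growStep : ∀ {t₀} (p : Progress t₀) {b} → b ∉ Progress.L p →
               Σ (Progress t₀) λ p′ → length (Progress.L p′) ≡ suc (length (Progress.L p))
    growStep p {b} b∉L with any? (λ a → any? (λ c → ¬? (c ∈? L) ×-dec overlap? t c a) (allFin n)) L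
      where open Progress p
    ... | yes crossing =
      let a , a∈L , outsiders = find crossing
          c , _ , c∉L , c∩a   = find outsiders
      in record p { L = c ∷ L ; tree = attach tree c∉L a∈L c∩a } , refl
      where open Progress p
    ... | no noCrossing =
      record { t = shiftOn t L d ; L = b ∷ L
             ; tree = attach (shiftTree d tree) b∉L (OverlapTree.root∈ tree) b∩root
             ; noWorse = ℕP.≤-trans (cost-shiftOn d closed) noWorse } , refl
      where
      open Progress p
      closed : Closed t L
      closed a∈L c∉L c∩a = noCrossing (lose a∈L (lose (∈-allFin _) (c∉L , c∩a)))
      d : ℤ
      d = proj₁ (realign t (OverlapTree.root∈ tree) b∉L)
      b∩root : Overlap (shiftOn t L d) b root
      b∩root = proj₂ (realign t (OverlapTree.root∈ tree) b∉L)

    grow : ∀ {t₀} k (p : Progress t₀) → n ≤ length (Progress.L p) ℕ.+ k →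
           Σ (Progress t₀) λ p′ → ∀ a → a ∈ Progress.L p′
    grow k p n≤ with any? (λ c → ¬? (c ∈? Progress.L p)) (allFin n)
    ... | no noneMissing =
      p , λ a → decidable-stable (a ∈? Progress.L p) (λ a∉ → noneMissing (lose (∈-allFin a) a∉))
    ... | yes missing with find missing
    ...   | b , _ , b∉L with k
    ...     | zero  = ⊥-elim (ℕP.<⇒≱ (missing⇒length< (OverlapTree.unique (Progress.tree p)) b∉L)
                                   (subst (n ≤_) (ℕP.+-identityʳ _) n≤))
    ...     | suc k = let p′ , grew = growStep p b∉L in
                      grow k p′ (subst (n ≤_) (trans (ℕP.+-suc _ k) (cong (ℕ._+ k) (≡.sym grew))) n≤)

    spanning : ∀ t₀ → Σ (Progress t₀) λ p → ∀ a → a ∈ Progress.L p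
    spanning t₀ = grow n start (ℕP.n≤1+n n)
      where
      start : Progress t₀
      start = record { t = t₀ ; L = [ root ] ; tree = seed t₀ root ; noWorse = ℕP.≤-refl }

    differences : List ℤ
    differences = concatMap (λ x → map (λ y → x - y) (union X)) (union X)

    sums : ℕ → List ℤ
    sums zero    = [ + 0 ]
    sums (suc k) = sums k ++ concatMap (λ q → map (λ e → q + e) differences) (sums k)

    zero∈sums : ∀ k → + 0 ∈ sums k
    zero∈sums zero    = here refl
    zero∈sums (suc k) = ∈-++⁺ˡ (zero∈sums k)

    sums-step : ∀ {k q e} → q ∈ sums k → e ∈ differences → q + e ∈ sums (suc k)
    sums-step {k} {q} q∈ e∈ =
      ∈-++⁺ʳ (sums k) (∈-concatMap⁺ (λ q → map (λ e → q + e) differences) (lose q∈ (∈-map⁺ (λ e → q + e) e∈)))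

    overlap∈differences : ∀ {t a b} → Overlap t a b → t a - t b ∈ differences
    overlap∈differences {t} a∩b =
      let x , y , x∈ , y∈ , t-diff = overlap-difference {t} a∩b
      in subst (_∈ differences) (≡.sym t-diff)
           (∈-concatMap⁺ (λ x → map (λ y → x - y) (union X)) (lose x∈ (∈-map⁺ (λ z → x - z) y∈)))

    -- Along a spanning overlap tree, the offset of a from the root adds up one difference
    -- per edge of the path to the root, so it is a sum of at most rank(a) + 1 differences.
    offset∈sums : ∀ {t L} (T : OverlapTree t root L) → (∀ a → a ∈ L) →
                  ∀ k a → OverlapTree.rank T a < k → t a - t root ∈ sums k
    offset∈sums {t} T spans (suc k) a ra<k with OverlapTree.descends T (spans a)
    ... | inj₁ refl = subst (_∈ sums (suc k)) (≡.sym (ℤP.+-inverseʳ (t root))) (zero∈sums (suc k))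
    ... | inj₂ down = subst (_∈ sums (suc k)) (≡.sym (offset-via (t a) (t p) (t root)))
                        (sums-step {k} (offset∈sums T spans k p (ℕP.<-≤-trans down (ℕP.≤-pred ra<k)))
                                       (overlap∈differences {t} (OverlapTree.overlapsParent T (spans a) down)))
      where
      p : Fin n
      p = OverlapTree.parent T a

    candidates : List (Fin n → ℤ)
    candidates = vectorsOver n (sums n)

    best : Fin n → ℤ
    best = argmin cost (λ _ → + 0) candidates

    -- The best candidate is optimal: any s is no better than its spanning improvement, whose
    -- normalisation t - t root is a candidate of the same cost.
    best-optimal : ∀ s → cost best ≤ cost s
    best-optimal s = begin
      cost best      ≤⟨ All.lookup (f[argmin]≤f[xs] {f = cost} (λ _ → + 0) candidates) f∈ ⟩
      cost f         ≡⟨ cost-≗ f≗ ⟩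
      cost offsets   ≡⟨ cost-uniform (- t root) (λ _ → refl) ⟩
      cost t         ≤⟨ noWorse ⟩
      cost s         ∎
      where
      open ℕP.≤-Reasoning
      p : Σ (Progress s) λ p → ∀ a → a ∈ Progress.L p
      p = spanning s
      open Progress (proj₁ p)
      offsets : Fin n → ℤ
      offsets a = t a - t root
      offsets∈ : ∀ a → offsets a ∈ sums n
      offsets∈ a = offset∈sums tree (proj₂ p) n a
        (ℕP.<-≤-trans (OverlapTree.rank< tree (proj₂ p a)) (unique-length≤ (OverlapTree.unique tree)))
      f : Fin n → ℤ
      f = proj₁ (vectorsOver-complete n (sums n) offsets offsets∈)
      f∈ : f ∈ candidates
      f∈ = proj₁ (proj₂ (vectorsOver-complete n (sums n) offsets offsets∈))
      f≗ : f ≗ offsets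
      f≗ = proj₂ (proj₂ (vectorsOver-complete n (sums n) offsets offsets∈))

    optimalSpanning : Σ (Progress best) λ p → (∀ a → a ∈ Progress.L p) × (∀ s → cost (Progress.t p) ≤ cost s)
    optimalSpanning = let p , spans = spanning best
                      in p , spans , λ s → ℕP.≤-trans (Progress.noWorse p) (best-optimal s)

emptyGraph : Graph 0
emptyGraph = record { Adj = λ _ _ → ⊥ ; sym = λ () ; irref = λ () }

emptyGraph-isTree : IsTree emptyGraph
emptyGraph-isTree = (λ ()) , λ cycle → noIndex (Cycle.v cycle)
  where
  noIndex : Fin 0 → ⊥
  noIndex ()

-- Take an optimal translation t with a spanning overlap tree, H the tree of its parent
-- map and ϖ(a,b) = t a - t b. Edges are overlaps, so their weights are differences of
-- elements of ⋃ X; solutions of S(H, ϖ) are translates of t, hence optimal as well.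
lemma3 : (n : ℕ) (X : Fin n → List ℤ) → (∀ a → NonEmptyList (X a)) →
    Σ (Graph n) λ H → Σ (Fin n → Fin n → ℤ) λ ϖ →
    IsTree H × IsAntisymmetricWeight H ϖ
    × (∀ a b → Adj H a b → ∃ λ x → ∃ λ y → x ∈ union X × y ∈ union X × ϖ a b ≡ x - y)
    × (∀ t → InS H ϖ t → ∀ (s : Fin n → ℤ) → card (unionTr X t) ≤ card (unionTr X s))
lemma3 zero X _ = emptyGraph , (λ _ _ → + 0) , emptyGraph-isTree , (λ _ _ ()) , (λ _ _ ()) , λ _ _ _ → z≤n
lemma3 (suc m) X nonEmpty =
  treeGraph , potentialWeight t , treeGraph-isTree , potentialWeight-antisym treeGraph t , edgeWeights , solutionsOptimal
  where
  open Overlaps X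
  open Growth nonEmpty zero
  open Progress (proj₁ optimalSpanning)
  spans : ∀ a → a ∈ L
  spans = proj₁ (proj₂ optimalSpanning)
  optimal : ∀ s → cost t ≤ cost s
  optimal = proj₂ (proj₂ optimalSpanning)
  open OverlapTree tree
  open RankedTree parent rank

  treeGraph-isTree : IsTree treeGraph
  treeGraph-isTree = isTree zero (λ a → descends (spans a))

  edgeWeights : ∀ a b → Adj treeGraph a b →
                ∃ λ x → ∃ λ y → x ∈ union X × y ∈ union X × potentialWeight t a b ≡ x - y
  edgeWeights a b (inj₁ a→b) = overlap-difference (childOverlap tree spans a→b)
  edgeWeights a b (inj₂ b→a) = overlap-difference (overlap-sym (childOverlap tree spans b→a))

  solutionsOptimal : ∀ t′ → InS treeGraph (potentialWeight t) t′ → ∀ s → cost t′ ≤ cost s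
  solutionsOptimal t′ t′∈S s = ℕP.≤-trans
    (ℕP.≤-reflexive (cost-uniform _ (solution-translate treeGraph t (proj₁ treeGraph-isTree) zero t′∈S)))
    (optimal s)
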